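{- Let $(G,W)$ be a realization of $S\subset\mathbb{Z}^n$, and let $\phi\colon V(G)\to S$, $\phi(v)=r(v\vert W)$. Then $(G^*_W,\phi(W))$ is a realization of $S$ that is equivalent to $(G,W)$.
   Context: All graphs are finite, simple and connected; $d$ is the shortest-path distance. For an ordered vertex subset $W=(\omega_1,\dots,\omega_n)$, $r(u\vert W)=(d(u,\omega_1),\dots,d(u,\omega_n))$; $W$ is resolving if $r(\cdot\vert W)$ is injective on $V(G)$. $(G,W)$ is a realization of $S\subset\mathbb{Z}^n$ if $W$ is a resolving set of $G$ and $S=\{r(u\vert W)\colon u\in V(G)\}$. Two realizations $(G,W)$ and $(G',W')$ of $S$ are equivalent if the map $f\colon V(G)\to V(G')$ determined by $r(u\vert W)=r(f(u)\vert W')$ is a graph isomorphism. $P_r$ is the path on $\{0,\dots,r-1\}$ with edges $\{i-1,i\}$; the strong product of $n$ copies of $P_r$ has vertex set $\{0,\dots,r-1\}^n$ with $x,y$ adjacent iff $\max_i\vert x_i-y_i\vert=1$. For a realization $(G,W)$ of $S$, $G^*_W$ denotes the subgraph of the strong product of $n$ copies of $P_r$, with $r\ge 1+\mathrm{diam}(G)$, having vertex set $S$ and edge set $\{xy\colon x=r(v\vert W),\ y=r(v'\vert W),\ vv'\in E(G)\}$; $\phi(W)=(r(\omega_1\vert W),\dots,r(\omega_n\vert W))$. -}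

module Defs where

open import Data.Nat using (ℕ; zero; suc; _≤_)
open import Data.Integer using (ℤ; +_)
open import Data.Fin using (Fin)
open import Data.Vec using (Vec; lookup)
open import Data.Bool using (Bool; T)
open import Data.Product using (Σ; ∃; _×_; proj₁)
open import Relation.Nullary using (¬_)
open import Relation.Binary.PropositionalEquality using (_≡_)
open import Function.Bundles using (_↔_; _⇔_)
open import Function.Definitions using (Injective; Bijective)

-- A (raw) graph: a vertex type and an adjacency relation.
-- Finiteness, simplicity and connectedness are imposed by IsGraph.
record Graph : Set₁ where
  field
    V : Set
    E : V → V → Set
open Graph public

data Walk (G : Graph) : V G → V G → ℕ → Set where
  nil  : ∀ {u} → Walk G u u 0
  cons : ∀ {u v w k} → E G u v → Walk G v w k → Walk G u w (suc k)

-- Finite, simple (loopless, undirected), connected, nonempty graph.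
IsGraph : Graph → Set
IsGraph G =
    (∃ λ m → V G ↔ Fin m)
  × V G
  × (∀ u → ¬ E G u u)
  × (∀ u v → E G u v → E G v u)
  × (∀ u v → ∃ λ k → Walk G u v k)

IsDist : (G : Graph) → V G → V G → ℕ → Set
IsDist G u v k = Walk G u v k × (∀ j → Walk G u v j → k ≤ j)

Rep : ∀ {n} (G : Graph) → Vec (V G) n → V G → Vec ℤ n → Set
Rep G W u x = ∀ i → ∃ λ k → (lookup x i ≡ + k) × IsDist G u (lookup W i) k

Resolving : ∀ {n} (G : Graph) → Vec (V G) n → Set
Resolving G W = ∀ u v x → Rep G W u x → Rep G W v x → u ≡ v

Realization : ∀ {n} (G : Graph) → Vec (V G) n → (Vec ℤ n → Bool) → Set
Realization G W S =
    IsGraph G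
  × Injective _≡_ _≡_ (lookup W)        -- W is an ordered vertex subset (distinct entries)
  × Resolving G W
  × (∀ x → T (S x) ⇔ (∃ λ u → Rep G W u x))

IsIso : (G G' : Graph) → (V G → V G') → Set
IsIso G G' f = Bijective _≡_ _≡_ f × (∀ u v → E G u v ⇔ E G' (f u) (f v))

Equivalent : ∀ {n} (G : Graph) → Vec (V G) n → (G' : Graph) → Vec (V G') n → Set
Equivalent G W G' W' =
  Σ (V G → V G') λ f → (∀ u x → Rep G W u x → Rep G' W' (f u) x) × IsIso G G' f

Gstar : ∀ {n} (G : Graph) → Vec (V G) n → (Vec ℤ n → Bool) → Graph
Gstar {n} G W S = record
  { V = Σ (Vec ℤ n) (λ x → T (S x))
  ; E = λ a b → ∃ λ v → ∃ λ v' →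
          Rep G W v (proj₁ a) × Rep G W v' (proj₁ b) × E G v v'
  }

-- Since W is resolving, φ is injective, and it is onto S because S consists exactly of the
-- vectors r(u | W); by the definition of G*_W it maps edges to edges, and (W being resolving
-- again) only edges to edges. So φ is a graph isomorphism G ≅ G*_W sending W to φ(W).
-- Isomorphisms preserve walks, hence distances, hence metric representations, so transporting
-- the realization (G, W) along φ gives a realization (G*_W, φ(W)) of the same S, equivalent via φ.
module Submission where

open import Defs
open import Data.Nat using (ℕ)
open import Data.Nat.Properties using (≤-antisym)
open import Data.Integer using (ℤ; +_)
open import Data.Bool using (Bool; T)
open import Data.Bool.Properties using (T-irrelevant)
open import Data.Vec using (Vec; map)
open import Data.Vec.Properties using (lookup-map)
open import Data.Vec.Relation.Binary.Pointwise.Extensional using (ext; Pointwise-≡⇒≡)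
open import Data.Product using (∃; _×_; _,_; proj₁; proj₂)
open import Data.Product.Properties using (Σ-≡,≡→≡)
open import Relation.Binary.PropositionalEquality
  using (_≡_; refl; sym; trans; cong; subst; subst₂)
open import Function.Bundles using (_↔_; mk⇔; mk⤖; Inverse; Equivalence)
open import Function.Definitions using (Injective)
open import Function.Construct.Composition using (_↔-∘_)
open import Function.Construct.Symmetry using (↔-sym)
open import Function.Properties.Bijection using (⤖⇒↔)

IsDist-functional : ∀ G {u v k l} → IsDist G u v k → IsDist G u v l → k ≡ l
IsDist-functional G (p , p-minimal) (q , q-minimal) = ≤-antisym (p-minimal _ q) (q-minimal _ p)

Rep-functional : ∀ {n} G (W : Vec (V G) n) {u} x y → Rep G W u x → Rep G W u y → x ≡ y
Rep-functional G W x y r s = Pointwise-≡⇒≡ (ext λ i →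
  let (k , xᵢ≡k , dist-k) = r i ; (l , yᵢ≡l , dist-l) = s i
  in trans xᵢ≡k (trans (cong +_ (IsDist-functional G dist-k dist-l)) (sym yᵢ≡l)))

Walk-map : ∀ {G H} (h : V G → V H) → (∀ {u v} → E G u v → E H (h u) (h v)) →
           ∀ {u w k} → Walk G u w k → Walk H (h u) (h w) k
Walk-map h h-edge nil        = nil
Walk-map h h-edge (cons e p) = cons (h-edge e) (Walk-map h h-edge p)

module Isomorphism {G H : Graph} {f : V G → V H} (iso : IsIso G H f) where

  f↔ : V G ↔ V H
  f↔ = ⤖⇒↔ (mk⤖ {to = f} (proj₁ iso))

  open Inverse f↔ using (from; strictlyInverseˡ; strictlyInverseʳ)

  f-injective : Injective _≡_ _≡_ f
  f-injective = proj₁ (proj₁ iso)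

  f-edge : ∀ {u v} → E G u v → E H (f u) (f v)
  f-edge {u} {v} = Equivalence.to (proj₂ iso u v)

  f-edge⁻ : ∀ {u v} → E H (f u) (f v) → E G u v
  f-edge⁻ {u} {v} = Equivalence.from (proj₂ iso u v)

  from-edge : ∀ {a b} → E H a b → E G (from a) (from b)
  from-edge {a} {b} e =
    f-edge⁻ (subst₂ (E H) (sym (strictlyInverseˡ a)) (sym (strictlyInverseˡ b)) e)

  Walk-reflect : ∀ {u w k} → Walk H (f u) (f w) k → Walk G u w k
  Walk-reflect {u} {w} {k} p =
    subst₂ (λ s t → Walk G s t k) (strictlyInverseʳ u) (strictlyInverseʳ w) (Walk-map from from-edge p)

  IsDist-preserve : ∀ {u v k} → IsDist G u v k → IsDist H (f u) (f v) k
  IsDist-preserve (p , p-minimal) = Walk-map f f-edge p , λ j q → p-minimal j (Walk-reflect q)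

  IsDist-reflect : ∀ {u v k} → IsDist H (f u) (f v) k → IsDist G u v k
  IsDist-reflect (p , p-minimal) = Walk-reflect p , λ j q → p-minimal j (Walk-map f f-edge q)

  module _ {n} (W : Vec (V G) n) where

    Rep-preserve : ∀ {u} x → Rep G W u x → Rep H (map f W) (f u) x
    Rep-preserve {u} x r i with r i
    ... | k , xᵢ≡k , d =
      k , xᵢ≡k , subst (λ w → IsDist H (f u) w k) (sym (lookup-map i f W)) (IsDist-preserve d)

    Rep-reflect : ∀ {u} x → Rep H (map f W) (f u) x → Rep G W u x
    Rep-reflect {u} x r i with r i
    ... | k , xᵢ≡k , d =
      k , xᵢ≡k , IsDist-reflect (subst (λ w → IsDist H (f u) w k) (lookup-map i f W) d)

    Rep-from : ∀ {a} x → Rep H (map f W) a x → Rep G W (from a) x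
    Rep-from {a} x r = Rep-reflect x (subst (λ b → Rep H (map f W) b x) (sym (strictlyInverseˡ a)) r)

    Resolving-transport : Resolving G W → Resolving H (map f W)
    Resolving-transport resolving a b x rₐ r_b =
      trans (sym (strictlyInverseˡ a))
        (trans (cong f (resolving (from a) (from b) x (Rep-from x rₐ) (Rep-from x r_b)))
               (strictlyInverseˡ b))

  IsGraph-transport : IsGraph G → IsGraph H
  IsGraph-transport ((m , V≅Fin) , v , loopless , symmetric , connected) =
      (m , V≅Fin ↔-∘ ↔-sym f↔)
    , f v
    , (λ a e → loopless (from a) (from-edge e))
    , (λ a b e → subst₂ (E H) (strictlyInverseˡ b) (strictlyInverseˡ a)
                   (f-edge (symmetric (from a) (from b) (from-edge e))))
    , λ a b → let (k , p) = connected (from a) (from b)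
              in k , subst₂ (λ s t → Walk H s t k) (strictlyInverseˡ a) (strictlyInverseˡ b)
                       (Walk-map f f-edge p)

  Realization-transport : ∀ {n} (W : Vec (V G) n) {S} →
    Realization G W S → Realization H (map f W) S × Equivalent G W H (map f W)
  Realization-transport W (isGraph , W-injective , resolving , S≡reps) =
      ( IsGraph-transport isGraph
      , (λ {i} {j} eq → W-injective (f-injective
          (trans (sym (lookup-map i f W)) (trans eq (lookup-map j f W)))))
      , Resolving-transport W resolving
      , λ x → mk⇔ (λ t → let (u , r) = Equivalence.to (S≡reps x) t in f u , Rep-preserve W x r)
                  (λ { (a , r) → Equivalence.from (S≡reps x) (from a , Rep-from W x r) }))
    , (f , (λ u → Rep-preserve W) , iso)

Gstar-iso : ∀ {n} (G : Graph) (W : Vec (V G) n) (S : Vec ℤ n → Bool) →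
  Resolving G W → (∀ x → T (S x) → ∃ λ u → Rep G W u x) →
  (φ : V G → V (Gstar G W S)) → (∀ v → Rep G W v (proj₁ (φ v))) →
  IsIso G (Gstar G W S) φ
Gstar-iso G W S resolving S⊆reps φ φ-rep =
  (φ-injective , φ-surjective) , λ u v → mk⇔ (λ e → u , v , φ-rep u , φ-rep v , e) (φ-edge⁻ u v)
  where
  φ-injective : Injective _≡_ _≡_ φ
  φ-injective {u} {v} eq =
    resolving u v (proj₁ (φ u)) (φ-rep u) (subst (λ a → Rep G W v (proj₁ a)) (sym eq) (φ-rep v))

  φ-surjective : ∀ a → ∃ λ u → ∀ {v} → v ≡ u → φ v ≡ a
  φ-surjective (x , t) with S⊆reps x t
  ... | u , r = u , λ { refl → Σ-≡,≡→≡ (Rep-functional G W _ x (φ-rep u) r , T-irrelevant _ _) }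

  φ-edge⁻ : ∀ u v → E (Gstar G W S) (φ u) (φ v) → E G u v
  φ-edge⁻ u v (u′ , v′ , r-u′ , r-v′ , e) =
    subst₂ (E G) (resolving u′ u (proj₁ (φ u)) r-u′ (φ-rep u)) (resolving v′ v (proj₁ (φ v)) r-v′ (φ-rep v)) e

corollary6 : ∀ {n : ℕ} (G : Graph) (W : Vec (V G) n) (S : Vec ℤ n → Bool)
    → Realization G W S
    → (φ : V G → V (Gstar G W S))
    → (∀ v → Rep G W v (proj₁ (φ v)))
    → Realization (Gstar G W S) (map φ W) S × Equivalent G W (Gstar G W S) (map φ W)
corollary6 G W S R@(_ , _ , resolving , S≡reps) φ φ-rep =
  Isomorphism.Realization-transport
    (Gstar-iso G W S resolving (λ x → Equivalence.to (S≡reps x)) φ φ-rep) W R
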